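{- Every totally-nested tri-separation $(A,B)$ of a 3-connected graph $G$ is half-connected, i.e. $G[A\setminus B]$ or $G[B\setminus A]$ is connected.
   Context: Mixed-separation: ordered pair $(A,B)$ with $A\cup B=V(G)$, $A\setminus B,B\setminus A\neq\emptyset$; separator = disjoint union of $A\cap B$ and $E(A\setminus B,B\setminus A)$. Tri-separation: separator of size three, every vertex of $A\cap B$ having at least two neighbours in $G[A]$ and $G[B]$. Totally nested: for every tri-separation $(C,D)$ of $G$, after possibly swapping $A,B$ or $C,D$, $A\subseteq C$ and $B\supseteq D$. -}

module Defs where

open import Data.Nat using (ℕ; _+_; _≤_; _≥_)
open import Data.Bool using (Bool; true; false)
open import Data.Fin using (Fin)
open import Data.Fin.Subset using (Subset; _∈_; _⊆_; _∩_; _∪_; _─_; ∣_∣; ⊤; ∁; Nonempty)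
open import Data.Vec using (tabulate)
open import Data.List using (allFin; map)
open import Data.Nat.ListAction using (sum)
open import Data.Product using (_×_; Σ-syntax)
open import Data.Sum using (_⊎_)
open import Relation.Binary.PropositionalEquality using (_≡_)

record Graph : Set where
  field
    n      : ℕ
    adj    : Fin n → Fin n → Bool
    sym    : ∀ u v → adj u v ≡ adj v u
    irrefl : ∀ v → adj v v ≡ false
open Graph public

module _ (G : Graph) where

  V : Set
  V = Fin (n G)

  VSet : Set
  VSet = Subset (n G)

  Adj : V → V → Set
  Adj u v = adj G u v ≡ true

  N : V → VSet
  N v = tabulate (adj G v)

  data WalkIn (S : VSet) : V → V → Set where
    here : ∀ {u} → WalkIn S u u
    step : ∀ {u w v} → Adj u w → w ∈ S → WalkIn S w v → WalkIn S u v

  ConnectedIn : VSet → Set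
  ConnectedIn S = Nonempty S × (∀ u v → u ∈ S → v ∈ S → WalkIn S u v)

  ThreeConnected : Set
  ThreeConnected = (n G ≥ 4) × (∀ (X : VSet) → ∣ X ∣ ≤ 2 → ConnectedIn (∁ X))

  IsMixedSep : VSet → VSet → Set
  IsMixedSep A B = (A ∪ B ≡ ⊤) × Nonempty (A ─ B) × Nonempty (B ─ A)

  sumV : (V → ℕ) → ℕ
  sumV f = sum (map f (allFin (n G)))

  -- |E(A∖B, B∖A)|: since A∖B and B∖A are disjoint each such edge is counted
  -- exactly once (by its end in A∖B)
  crossEdges : VSet → VSet → ℕ
  crossEdges A B = sumV (λ u → Data.Bool.if Data.Vec.lookup (A ─ B) u
                                          then ∣ N u ∩ (B ─ A) ∣ else 0)

  sepSize : VSet → VSet → ℕ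
  sepSize A B = ∣ A ∩ B ∣ + crossEdges A B

  IsTriSep : VSet → VSet → Set
  IsTriSep A B = IsMixedSep A B × (sepSize A B ≡ 3)
               × (∀ v → v ∈ A ∩ B → (∣ N v ∩ A ∣ ≥ 2) × (∣ N v ∩ B ∣ ≥ 2))

  -- (A,B) and (C,D) are nested: after possibly swapping A,B or C,D,
  -- A ⊆ C and B ⊇ D
  Nested : VSet → VSet → VSet → VSet → Set
  Nested A B C D = ((A ⊆ C) × (D ⊆ B)) ⊎ ((B ⊆ C) × (D ⊆ A))
                 ⊎ ((A ⊆ D) × (C ⊆ B)) ⊎ ((B ⊆ D) × (C ⊆ A))

  TotallyNested : VSet → VSet → Set
  TotallyNested A B = ∀ C D → IsTriSep C D → Nested A B C D

  HalfConnected : VSet → VSet → Set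
  HalfConnected A B = ConnectedIn (A ─ B) ⊎ ConnectedIn (B ─ A)

-- Write X = A ∖ B, Y = B ∖ A, Z = A ∩ B, and suppose u, v lie in different components of G[X]
-- and p, q in different components of G[Y]. For the component K of u, the set Z ∪ (N(K) ∩ Y)
-- separates u from v, so by 3-connectivity K sends at least 3 − |Z| = |E(X,Y)| edges to Y; so
-- does the component of v, while together they send at most |E(X,Y)|. Hence E(X,Y) = ∅ and
-- |Z| = 3, every component of G[X] or G[Y] has all its outside neighbours in Z, and every z ∈ Z
-- has a neighbour in each of the components of u, v, p, q (otherwise Z − z would separate).
-- With K the union of the components of u and p, (Z ∪ K, V ∖ K) is then a tri-separation, and it
-- is not nested with (A, B): v, q ∉ Z ∪ K while u, p ∈ K.
module Submission where

open import Defs hiding (sym)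
open import Data.Nat using (ℕ; zero; suc; _+_; _≤_; _<_; _≥_; _≤?_; z≤n; s≤s; s≤s⁻¹)
open import Data.Nat.Properties
  using ( +-0-commutativeMonoid; ≤-refl; ≤-trans; ≤-reflexive; ≤⇒≯; ≰⇒>; n≤0⇒n≡0; n≤1+n
        ; m≤m+n; m≤n+m; +-suc; +-identityʳ; +-mono-≤; +-monoʳ-≤; +-cancelˡ-≤; module ≤-Reasoning)
open import Data.Bool using (Bool; true; false; if_then_else_)
import Data.Bool.Properties as Bool
open import Data.Fin using (Fin; zero; suc; _≟_)
open import Data.Fin.Properties using (any?)
import Data.List as List
open import Data.List.Properties using (map-tabulate)
open import Data.Nat.ListAction using () renaming (sum to listSum)
open import Data.Fin.Subset using (Subset; _∈_; _∉_; _⊆_; _∩_; _∪_; _─_; _-_; ∁; ⊤; ∣_∣; ⁅_⁆; Nonempty)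
open import Data.Fin.Subset.Properties
  using ( _∈?_; ∈⊤; ⊆⊤; ⊆-antisym; p⊆q⇒∣p∣≤∣q∣; ∣⁅x⁆∣≡1; x∈⁅y⁆⇒x≡y
        ; x∈p∩q⁺; x∈p∩q⁻; p∩q⊆p; p∩q⊆q; x∈p∪q⁺; x∈p∪q⁻; x∉p⇒x∈∁p; x∈∁p⇒x∉p; x∉∁p⇒x∈p; x∈p⇒x∉∁p
        ; x∈p∧x∉q⇒x∈p─q; p─q⊆p; x∈p∧x≢y⇒x∈p-y; x∈p⇒∣p-x∣<∣p∣)
open import Data.Vec using ([]; _∷_; lookup; tabulate; there)
open import Data.Vec.Properties using ([]=⇒lookup; lookup⇒[]=; lookup∘tabulate)
open import Data.Product using (∃; ∃₂; _×_; _,_; proj₁; proj₂)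
open import Data.Sum using (_⊎_; inj₁; inj₂; reduce; [_,_]; map₁)
open import Data.Empty using (⊥; ⊥-elim)
open import Function using (_∘_; const; id)
open import Relation.Nullary using (¬_; Dec; yes; no; does; ¬?)
open import Relation.Nullary.Decidable using (dec-true; map′; _×-dec_)
open import Relation.Binary.PropositionalEquality
  using (_≡_; _≢_; refl; sym; trans; cong; cong₂; subst)
open import Algebra.Properties.CommutativeMonoid.Sum +-0-commutativeMonoid
  using (sum; ∑-comm; ∑-distrib-+; sum-cong-≗)

-- Finite sums and cardinalities

∑-mono-≤ : ∀ {m} {f g : Fin m → ℕ} → (∀ i → f i ≤ g i) → sum f ≤ sum g
∑-mono-≤ {zero}  f≤g = z≤n
∑-mono-≤ {suc m} f≤g = +-mono-≤ (f≤g zero) (∑-mono-≤ (f≤g ∘ suc))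

f≤∑f : ∀ {m} (f : Fin m → ℕ) i → f i ≤ sum f
f≤∑f f zero    = m≤m+n _ _
f≤∑f f (suc i) = ≤-trans (f≤∑f (f ∘ suc) i) (m≤n+m _ _)

∑-zero : ∀ {m} (f : Fin m → ℕ) → (∀ i → f i ≡ 0) → sum f ≡ 0
∑-zero {zero}  f f≡0 = refl
∑-zero {suc m} f f≡0 rewrite f≡0 zero = ∑-zero (f ∘ suc) (f≡0 ∘ suc)

sumOver : ∀ {m} → Subset m → (Fin m → ℕ) → ℕ
sumOver S f = sum (λ x → if lookup S x then f x else 0)

∣p∣≡sumOver1 : ∀ {m} (p : Subset m) → ∣ p ∣ ≡ sumOver p (const 1)
∣p∣≡sumOver1 []          = refl
∣p∣≡sumOver1 (true  ∷ p) = cong suc (∣p∣≡sumOver1 p)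
∣p∣≡sumOver1 (false ∷ p) = ∣p∣≡sumOver1 p

f≤sumOver : ∀ {m} {S : Subset m} (f : Fin m → ℕ) {x} → x ∈ S → f x ≤ sumOver S f
f≤sumOver {S = S} f {x} x∈S with f≤∑f (λ y → if lookup S y then f y else 0) x
... | fx≤ rewrite []=⇒lookup x∈S = fx≤

sumOver≡0⇒ : ∀ {m} {S : Subset m} (f : Fin m → ℕ) → sumOver S f ≡ 0 → ∀ {x} → x ∈ S → f x ≡ 0
sumOver≡0⇒ f ∑≡0 x∈S = n≤0⇒n≡0 (subst (_ ≤_) ∑≡0 (f≤sumOver f x∈S))

sumOver-zero : ∀ {m} (S : Subset m) (f : Fin m → ℕ) → (∀ {x} → x ∈ S → f x ≡ 0) → sumOver S f ≡ 0
sumOver-zero S f f≡0 = ∑-zero _ term≡0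
  where
  term≡0 : ∀ x → (if lookup S x then f x else 0) ≡ 0
  term≡0 x with lookup S x in eq
  ... | true  = f≡0 (lookup⇒[]= x S eq)
  ... | false = refl

sumOver-disjoint : ∀ {m} {S S′ P : Subset m} (f : Fin m → ℕ)
                 → (∀ {x} → x ∈ S → x ∈ S′ → ⊥) → S ⊆ P → S′ ⊆ P
                 → sumOver S f + sumOver S′ f ≤ sumOver P f
sumOver-disjoint {m} {S} {S′} {P} f disjoint S⊆P S′⊆P = begin
  sumOver S f + sumOver S′ f  ≡⟨ sym (∑-distrib-+ (term S) (term S′)) ⟩
  sum {m} (λ x → term S x + term S′ x) ≤⟨ ∑-mono-≤ term-≤ ⟩
  sumOver P f ∎
  where
  open ≤-Reasoning
  term : Subset m → Fin m → ℕ
  term Q x = if lookup Q x then f x else 0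
  ∈P : ∀ {Q} x → Q ⊆ P → lookup Q x ≡ true → lookup P x ≡ true
  ∈P {Q} x Q⊆P eq = []=⇒lookup (Q⊆P (lookup⇒[]= x Q eq))
  term-≤ : ∀ x → term S x + term S′ x ≤ term P x
  term-≤ x with lookup S x in eS | lookup S′ x in eS′
  ... | true  | true  = ⊥-elim (disjoint (lookup⇒[]= x S eS) (lookup⇒[]= x S′ eS′))
  ... | true  | false rewrite ∈P x S⊆P eS = ≤-reflexive (+-identityʳ (f x))
  ... | false | true  rewrite ∈P x S′⊆P eS′ = ≤-refl
  ... | false | false = z≤n

∑-if : ∀ {m} (b : Bool) (g : Fin m → ℕ) → sum (λ y → if b then g y else 0) ≡ (if b then sum g else 0)
∑-if true  g = refl
∑-if {m} false g = ∑-zero {m} _ (λ _ → refl)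

∣⋃∣≤sumOver : ∀ {m k} (K : Subset m) (F : Fin m → Subset k) (U : Subset k)
            → (∀ {y} → y ∈ U → ∃ λ x → x ∈ K × y ∈ F x)
            → ∣ U ∣ ≤ sumOver K (∣_∣ ∘ F)
∣⋃∣≤sumOver {m} {k} K F U covered = begin
  ∣ U ∣                                                     ≡⟨ ∣p∣≡sumOver1 U ⟩
  sumOver U (const 1)                                       ≤⟨ ∑-mono-≤ covered-once ⟩
  sum {k} (λ y → sum {m} (λ x → if lookup K x then 𝟙 x y else 0))  ≡⟨ sym (∑-comm {m} {k} _) ⟩
  sum {m} (λ x → sum {k} (λ y → if lookup K x then 𝟙 x y else 0))  ≡⟨ sum-cong-≗ (λ x → ∑-if (lookup K x) (𝟙 x)) ⟩
  sum {m} (λ x → if lookup K x then sumOver (F x) (const 1) else 0)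
                                                            ≡⟨ sum-cong-≗ (λ x → cong (if lookup K x then_else 0) (sym (∣p∣≡sumOver1 (F x)))) ⟩
  sumOver K (∣_∣ ∘ F)                                       ∎
  where
  open ≤-Reasoning
  𝟙 : Fin m → Fin k → ℕ
  𝟙 x y = if lookup (F x) y then 1 else 0
  covered-once : ∀ y → (if lookup U y then 1 else 0) ≤ sumOver K (λ x → 𝟙 x y)
  covered-once y with lookup U y in eU
  ... | false = z≤n
  ... | true with covered (lookup⇒[]= y U eU)
  ...   | x , x∈K , y∈Fx with f≤sumOver (λ x → 𝟙 x y) x∈K
  ...     | 𝟙≤ rewrite []=⇒lookup y∈Fx = 𝟙≤

∣p∪q∣≤∣p∣+∣q∣ : ∀ {m} (p q : Subset m) → ∣ p ∪ q ∣ ≤ ∣ p ∣ + ∣ q ∣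
∣p∪q∣≤∣p∣+∣q∣ []          []          = z≤n
∣p∪q∣≤∣p∣+∣q∣ (true  ∷ p) (true  ∷ q) = s≤s (≤-trans (∣p∪q∣≤∣p∣+∣q∣ p q) (+-monoʳ-≤ ∣ p ∣ (n≤1+n ∣ q ∣)))
∣p∪q∣≤∣p∣+∣q∣ (true  ∷ p) (false ∷ q) = s≤s (∣p∪q∣≤∣p∣+∣q∣ p q)
∣p∪q∣≤∣p∣+∣q∣ (false ∷ p) (true  ∷ q) rewrite +-suc ∣ p ∣ ∣ q ∣ = s≤s (∣p∪q∣≤∣p∣+∣q∣ p q)
∣p∪q∣≤∣p∣+∣q∣ (false ∷ p) (false ∷ q) = ∣p∪q∣≤∣p∣+∣q∣ p q

x∈p⇒0<∣p∣ : ∀ {m} {p : Subset m} {x} → x ∈ p → 0 < ∣ p ∣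
x∈p⇒0<∣p∣ {x = x} x∈p =
  subst (_≤ _) (∣⁅x⁆∣≡1 x) (p⊆q⇒∣p∣≤∣q∣ λ y∈⁅x⁆ → subst (_∈ _) (sym (x∈⁅y⁆⇒x≡y x y∈⁅x⁆)) x∈p)

x,y∈p⇒1<∣p∣ : ∀ {m} {p : Subset m} {x y} → x ∈ p → y ∈ p → x ≢ y → 1 < ∣ p ∣
x,y∈p⇒1<∣p∣ {x = x} x∈p y∈p x≢y =
  ≤-trans (s≤s (x∈p⇒0<∣p∣ (x∈p∧x≢y⇒x∈p-y y∈p (x≢y ∘ sym)))) (x∈p⇒∣p-x∣<∣p∣ x∈p)

sum-allFin : ∀ {m} (f : Fin m → ℕ) → listSum (List.map f (List.allFin m)) ≡ sum f
sum-allFin f = trans (cong listSum (map-tabulate (λ x → x) f)) (sum-tabulate f)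
  where
  sum-tabulate : ∀ {m} (f : Fin m → ℕ) → listSum (List.tabulate f) ≡ sum f
  sum-tabulate {zero}  f = refl
  sum-tabulate {suc m} f = cong (f zero +_) (sum-tabulate (f ∘ suc))

x∈p─q⇒x∉q : ∀ {m} (p q : Subset m) {x} → x ∈ p ─ q → x ∉ q
x∈p─q⇒x∉q (_ ∷ p) (true  ∷ q) (there x∈) (there x∈q) = x∈p─q⇒x∉q p q x∈ x∈q
x∈p─q⇒x∉q (_ ∷ p) (false ∷ q) (there x∈) (there x∈q) = x∈p─q⇒x∉q p q x∈ x∈q

decSubset : ∀ {m} {P : Fin m → Set} → (∀ x → Dec (P x)) → Subset m
decSubset P? = tabulate (does ∘ P?)

∈-decSubset⁺ : ∀ {m} {P : Fin m → Set} (P? : ∀ x → Dec (P x)) {x} → P x → x ∈ decSubset P?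
∈-decSubset⁺ P? {x} px = lookup⇒[]= x _ (trans (lookup∘tabulate _ x) (dec-true (P? x) px))

∈-decSubset⁻ : ∀ {m} {P : Fin m → Set} (P? : ∀ x → Dec (P x)) {x} → x ∈ decSubset P? → P x
∈-decSubset⁻ P? {x} x∈ with P? x | trans (sym (lookup∘tabulate (does ∘ P?) x)) ([]=⇒lookup x∈)
... | yes px | _ = px
... | no _   | ()

-- Walks, components and separators

module _ (G : Graph) where

  private variable
    S T K K′ : VSet G
    u v w x y z : V G

  Adj? : ∀ x y → Dec (Adj G x y)
  Adj? x y = adj G x y Bool.≟ true

  Adj-sym : Adj G x y → Adj G y x
  Adj-sym {x} {y} xy = trans (Graph.sym G y x) xy

  ∈N⁺ : Adj G x y → y ∈ N G x
  ∈N⁺ {x} {y} xy = lookup⇒[]= y _ (trans (lookup∘tabulate (adj G x) y) xy)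

  ∈N⁻ : y ∈ N G x → Adj G x y
  ∈N⁻ {y} {x} y∈ = trans (sym (lookup∘tabulate (adj G x) y)) ([]=⇒lookup y∈)

  _++_ : WalkIn G S u w → WalkIn G S w v → WalkIn G S u v
  here            ++ q = q
  step uw w∈S p   ++ q = step uw w∈S (p ++ q)

  reverse : u ∈ S → WalkIn G S u v → WalkIn G S v u
  reverse u∈S here              = here
  reverse u∈S (step uw w∈S p)   = reverse w∈S p ++ step (Adj-sym uw) u∈S here

  end∈ : u ∈ S → WalkIn G S u v → v ∈ S
  end∈ u∈S here            = u∈S
  end∈ u∈S (step _ w∈S p)  = end∈ w∈S p

  WalkIn-mono : S ⊆ T → WalkIn G S u v → WalkIn G T u v
  WalkIn-mono S⊆T here             = here
  WalkIn-mono S⊆T (step uw w∈S p)  = step uw (S⊆T w∈S) (WalkIn-mono S⊆T p)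

  avoid : ∀ w → WalkIn G S u v → WalkIn G (S - w) u v ⊎ WalkIn G (S - w) w v
  avoid w here = inj₁ here
  avoid w (step {w = x} ux x∈S p) with avoid w p
  ... | inj₂ q = inj₂ q
  ... | inj₁ q with x ≟ w
  ...   | yes refl = inj₂ q
  ...   | no x≢w   = inj₁ (step ux (x∈p∧x≢y⇒x∈p-y x∈S x≢w) q)

  -- Recursion on ∣ S ∣: by avoid, a walk from u ≢ v may continue from its first vertex w inside S - w.
  walk? : ∀ S u v → Dec (WalkIn G S u v)
  walk? S = bounded ∣ S ∣ S ≤-refl
    where
    bounded : ∀ k S → ∣ S ∣ ≤ k → ∀ u v → Dec (WalkIn G S u v)
    bounded zero S ∣S∣≤0 u v = map′ (λ { refl → here }) stays (u ≟ v)
      where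
      stays : WalkIn G S u v → u ≡ v
      stays here             = refl
      stays (step _ w∈S _)   = ⊥-elim (≤⇒≯ ∣S∣≤0 (x∈p⇒0<∣p∣ w∈S))
    bounded (suc k) S ∣S∣≤1+k u v with u ≟ v
    ... | yes refl = yes here
    ... | no u≢v   = map′ takeStep firstStep (any? λ w → Adj? u w ×-dec rest? w)
      where
      rest? : ∀ w → Dec (w ∈ S × WalkIn G (S - w) w v)
      rest? w with w ∈? S
      ... | no w∉S  = no (w∉S ∘ proj₁)
      ... | yes w∈S = map′ (w∈S ,_) proj₂
                        (bounded k (S - w) (s≤s⁻¹ (≤-trans (x∈p⇒∣p-x∣<∣p∣ w∈S) ∣S∣≤1+k)) w v)
      takeStep : (∃ λ w → Adj G u w × w ∈ S × WalkIn G (S - w) w v) → WalkIn G S u v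
      takeStep (w , uw , w∈S , p) = step uw w∈S (WalkIn-mono (p─q⊆p S ⁅ w ⁆) p)
      firstStep : WalkIn G S u v → ∃ λ w → Adj G u w × w ∈ S × WalkIn G (S - w) w v
      firstStep here                        = ⊥-elim (u≢v refl)
      firstStep (step {w = w} uw w∈S p)     = w , uw , w∈S , reduce (avoid w p)

  component : VSet G → V G → VSet G
  component S u = decSubset (walk? S u)

  ∈component⁺ : WalkIn G S u x → x ∈ component S u
  ∈component⁺ {S} {u} = ∈-decSubset⁺ (walk? S u)

  ∈component⁻ : x ∈ component S u → WalkIn G S u x
  ∈component⁻ {x} {S} {u} = ∈-decSubset⁻ (walk? S u)

  ∈component-self : ∀ S u → u ∈ component S u
  ∈component-self S u = ∈component⁺ {S = S} here

  component⊆ : u ∈ S → component S u ⊆ S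
  component⊆ u∈S = end∈ u∈S ∘ ∈component⁻

  component-closed : x ∈ component S u → Adj G x y → y ∈ S → y ∈ component S u
  component-closed x∈C xy y∈S = ∈component⁺ (∈component⁻ x∈C ++ step xy y∈S here)

  components-disjoint : v ∈ S → ¬ WalkIn G S u v → x ∈ component S u → x ∉ component S v
  components-disjoint v∈S ¬u⇝v x∈Cu x∈Cv = ¬u⇝v (∈component⁻ x∈Cu ++ reverse v∈S (∈component⁻ x∈Cv))

  connected-or-split : Nonempty S → ConnectedIn G S ⊎ ∃₂ λ u v → u ∈ S × v ∈ S × ¬ WalkIn G S u v
  connected-or-split {S} nonempty with any? (λ u → any? λ v → u ∈? S ×-dec v ∈? S ×-dec ¬? (walk? S u v))
  ... | yes (u , v , split) = inj₂ (u , v , split)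
  ... | no ¬split           = inj₁ (nonempty , connect)
    where
    connect : ∀ u v → u ∈ S → v ∈ S → WalkIn G S u v
    connect u v u∈S v∈S with walk? S u v
    ... | yes u⇝v = u⇝v
    ... | no ¬u⇝v = ⊥-elim (¬split (u , v , u∈S , v∈S , ¬u⇝v))

  BoundaryWithin : VSet G → VSet G → Set
  BoundaryWithin K T = ∀ {x y} → x ∈ K → Adj G x y → y ∈ K ⊎ y ∈ T

  component-boundary : u ∈ S → BoundaryWithin S T → BoundaryWithin (component S u) T
  component-boundary u∈S ∂S⊆T x∈C xy = map₁ (component-closed x∈C xy) (∂S⊆T (component⊆ u∈S x∈C) xy)

  boundary-∪ : BoundaryWithin K T → BoundaryWithin K′ T → BoundaryWithin (K ∪ K′) T
  boundary-∪ {K} {T} {K′} ∂K ∂K′ x∈K∪K′ xy with x∈p∪q⁻ K K′ x∈K∪K′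
  ... | inj₁ x∈K  = map₁ (x∈p∪q⁺ ∘ inj₁) (∂K x∈K xy)
  ... | inj₂ x∈K′ = map₁ (x∈p∪q⁺ ∘ inj₂) (∂K′ x∈K′ xy)

  separator-size : ThreeConnected G → BoundaryWithin K T → u ∈ K → v ∉ K → u ∉ T → v ∉ T → 2 < ∣ T ∣
  separator-size {K} {T} {u} {v} (_ , robust) ∂K u∈K v∉K u∉T v∉T with ∣ T ∣ ≤? 2
  ... | no ∣T∣≰2 = ≰⇒> ∣T∣≰2
  ... | yes ∣T∣≤2 = ⊥-elim (v∉K (stay u∈K (proj₂ (robust T ∣T∣≤2) u v (x∉p⇒x∈∁p u∉T) (x∉p⇒x∈∁p v∉T))))
    where
    stay : ∀ {x y} → x ∈ K → WalkIn G (∁ T) x y → y ∈ K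
    stay x∈K here = x∈K
    stay x∈K (step xw w∉T p) with ∂K x∈K xw
    ... | inj₁ w∈K = stay w∈K p
    ... | inj₂ w∈T = ⊥-elim (x∈∁p⇒x∉p w∉T w∈T)

  separator-attached : ThreeConnected G → BoundaryWithin K T → ∣ T ∣ ≤ 3
                     → u ∈ K → v ∉ K → u ∉ T → v ∉ T → z ∈ T → ∃ λ a → a ∈ K × Adj G z a
  separator-attached {K} {T} {u} {v} {z} tc ∂K ∣T∣≤3 u∈K v∉K u∉T v∉T z∈T
    with any? (λ a → a ∈? K ×-dec Adj? z a)
  ... | yes attached = attached
  ... | no ¬attached = ⊥-elim (≤⇒≯ ∣T∣≤3 (≤-trans (s≤s 2<∣T-z∣) (x∈p⇒∣p-x∣<∣p∣ z∈T)))
    where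
    ∂K⊆T-z : BoundaryWithin K (T - z)
    ∂K⊆T-z {x} {y} x∈K xy with ∂K x∈K xy
    ... | inj₁ y∈K = inj₁ y∈K
    ... | inj₂ y∈T with y ≟ z
    ...   | yes refl = ⊥-elim (¬attached (x , x∈K , Adj-sym xy))
    ...   | no y≢z   = inj₂ (x∈p∧x≢y⇒x∈p-y y∈T y≢z)
    2<∣T-z∣ : 2 < ∣ T - z ∣
    2<∣T-z∣ = separator-size tc ∂K⊆T-z u∈K v∉K (u∉T ∘ p─q⊆p T ⁅ z ⁆) (v∉T ∘ p─q⊆p T ⁅ z ⁆)

  component-attached : ThreeConnected G → BoundaryWithin S T → ∣ T ∣ ≤ 3 → (∀ {x} → x ∈ S → x ∉ T)
                     → u ∈ S → v ∈ S → ¬ WalkIn G S u v → z ∈ T → ∃ λ a → a ∈ component S u × Adj G z a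
  component-attached {S = S} tc ∂S ∣T∣≤3 S∩T=∅ u∈S v∈S ¬u⇝v =
    separator-attached tc (component-boundary u∈S ∂S) ∣T∣≤3 (∈component-self S _) (¬u⇝v ∘ ∈component⁻)
                       (S∩T=∅ u∈S) (S∩T=∅ v∈S)

  two-neighbours : ∀ {P Q R} → (∃ λ a → a ∈ P × Adj G z a) → (∃ λ b → b ∈ Q × Adj G z b)
                 → (∀ {x} → x ∈ P → x ∉ Q) → P ⊆ R → Q ⊆ R → 2 ≤ ∣ N G z ∩ R ∣
  two-neighbours (a , a∈P , za) (b , b∈Q , zb) P∩Q=∅ P⊆R Q⊆R =
    x,y∈p⇒1<∣p∣ (x∈p∩q⁺ (∈N⁺ za , P⊆R a∈P)) (x∈p∩q⁺ (∈N⁺ zb , Q⊆R b∈Q)) λ { refl → P∩Q=∅ a∈P b∈Q }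

  hasNeighbourIn? : ∀ K y → Dec (∃ λ x → x ∈ K × Adj G x y)
  hasNeighbourIn? K y = any? λ x → x ∈? K ×-dec Adj? x y

  neighbourhood : VSet G → VSet G
  neighbourhood K = decSubset (hasNeighbourIn? K)

  ∈neighbourhood⁺ : x ∈ K → Adj G x y → y ∈ neighbourhood K
  ∈neighbourhood⁺ {x} {K} x∈K xy = ∈-decSubset⁺ (hasNeighbourIn? K) (x , x∈K , xy)

  ∈neighbourhood⁻ : y ∈ neighbourhood K → ∃ λ x → x ∈ K × Adj G x y
  ∈neighbourhood⁻ {K = K} = ∈-decSubset⁻ (hasNeighbourIn? K)

  edgeCount : VSet G → VSet G → ℕ
  edgeCount P Q = sumOver P (λ x → ∣ N G x ∩ Q ∣)

  crossEdges≡edgeCount : ∀ A B → crossEdges G A B ≡ edgeCount (A ─ B) (B ─ A)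
  crossEdges≡edgeCount A B = sum-allFin (λ x → if lookup (A ─ B) x then ∣ N G x ∩ (B ─ A) ∣ else 0)

  ∣neighbourhood∩Q∣≤edgeCount : ∀ K Q → ∣ neighbourhood K ∩ Q ∣ ≤ edgeCount K Q
  ∣neighbourhood∩Q∣≤edgeCount K Q = ∣⋃∣≤sumOver K (λ x → N G x ∩ Q) (neighbourhood K ∩ Q) covered
    where
    covered : ∀ {y} → y ∈ neighbourhood K ∩ Q → ∃ λ x → x ∈ K × y ∈ N G x ∩ Q
    covered y∈ with x∈p∩q⁻ _ Q y∈
    ... | y∈NK , y∈Q with ∈neighbourhood⁻ y∈NK
    ...   | x , x∈K , xy = x , x∈K , x∈p∩q⁺ (∈N⁺ xy , y∈Q)

  edgeCount≡0⇒¬Adj : ∀ {P Q} → edgeCount P Q ≡ 0 → x ∈ P → y ∈ Q → ¬ Adj G x y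
  edgeCount≡0⇒¬Adj e≡0 x∈P y∈Q xy =
    ≤⇒≯ (≤-reflexive (sumOver≡0⇒ _ e≡0 x∈P)) (x∈p⇒0<∣p∣ (x∈p∩q⁺ (∈N⁺ xy , y∈Q)))

  ¬Adj⇒edgeCount≡0 : ∀ {P Q} → (∀ {x y} → x ∈ P → y ∈ Q → ¬ Adj G x y) → edgeCount P Q ≡ 0
  ¬Adj⇒edgeCount≡0 {P} {Q} ¬adj = sumOver-zero P _ λ {x} x∈P →
    trans (∣p∣≡sumOver1 (N G x ∩ Q)) (sumOver-zero _ _ λ y∈ →
      ⊥-elim (¬adj x∈P (proj₂ (x∈p∩q⁻ _ Q y∈)) (∈N⁻ (proj₁ (x∈p∩q⁻ _ Q y∈)))))

-- A tri-separation whose two sides are both disconnected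

module _ (G : Graph) (tc : ThreeConnected G) {A B : VSet G} (ts : IsTriSep G A B) where

  private variable
    u v x y : V G

  private
    X Y Z : VSet G
    X = A ─ B
    Y = B ─ A
    Z = A ∩ B

  region : ∀ x → x ∈ Z ⊎ x ∈ X ⊎ x ∈ Y
  region x with x ∈? A | x ∈? B
  ... | yes x∈A | yes x∈B = inj₁ (x∈p∩q⁺ (x∈A , x∈B))
  ... | yes x∈A | no x∉B  = inj₂ (inj₁ (x∈p∧x∉q⇒x∈p─q x∈A x∉B))
  ... | no x∉A  | yes x∈B = inj₂ (inj₂ (x∈p∧x∉q⇒x∈p─q x∈B x∉A))
  ... | no x∉A  | no x∉B  =
    ⊥-elim ([ x∉A , x∉B ] (x∈p∪q⁻ A B (subst (x ∈_) (sym (proj₁ (proj₁ ts))) ∈⊤)))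

  X∩Z=∅ : x ∈ X → x ∉ Z
  X∩Z=∅ x∈X x∈Z = x∈p─q⇒x∉q A B x∈X (p∩q⊆q A B x∈Z)

  Y∩Z=∅ : x ∈ Y → x ∉ Z
  Y∩Z=∅ x∈Y x∈Z = x∈p─q⇒x∉q B A x∈Y (p∩q⊆p A B x∈Z)

  X∩Y=∅ : x ∈ X → x ∉ Y
  X∩Y=∅ x∈X x∈Y = x∈p─q⇒x∉q B A x∈Y (p─q⊆p A B x∈X)

  ∣Z∣+cross≡3 : ∣ Z ∣ + edgeCount G X Y ≡ 3
  ∣Z∣+cross≡3 = trans (cong (∣ Z ∣ +_) (sym (crossEdges≡edgeCount G A B))) (proj₁ (proj₂ ts))

  cross≤edgeCount-component : u ∈ X → v ∈ X → ¬ WalkIn G X u v → edgeCount G X Y ≤ edgeCount G (component G X u) Y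
  cross≤edgeCount-component {u} {v} u∈X v∈X ¬u⇝v = +-cancelˡ-≤ ∣ Z ∣ _ _ (begin
    ∣ Z ∣ + edgeCount G X Y             ≡⟨ ∣Z∣+cross≡3 ⟩
    3                                   ≤⟨ separator-size G tc ∂K⊆T (∈component-self G X _) (¬u⇝v ∘ ∈component⁻ G)
                                                          (X∩T=∅ u∈X) (X∩T=∅ v∈X) ⟩
    ∣ T ∣                               ≤⟨ ∣p∪q∣≤∣p∣+∣q∣ Z _ ⟩
    ∣ Z ∣ + ∣ neighbourhood G K ∩ Y ∣   ≤⟨ +-monoʳ-≤ ∣ Z ∣ (∣neighbourhood∩Q∣≤edgeCount G K Y) ⟩
    ∣ Z ∣ + edgeCount G K Y             ∎)
    where
    open ≤-Reasoning
    K T : VSet G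
    K = component G X u
    T = Z ∪ (neighbourhood G K ∩ Y)
    X∩T=∅ : x ∈ X → x ∉ T
    X∩T=∅ {x} x∈X x∈T with x∈p∪q⁻ Z _ x∈T
    ... | inj₁ x∈Z   = X∩Z=∅ x∈X x∈Z
    ... | inj₂ x∈N∩Y = X∩Y=∅ x∈X (p∩q⊆q _ Y x∈N∩Y)
    ∂K⊆T : BoundaryWithin G K T
    ∂K⊆T {x} {y} x∈K xy with region y
    ... | inj₁ y∈Z        = inj₂ (x∈p∪q⁺ (inj₁ y∈Z))
    ... | inj₂ (inj₁ y∈X) = inj₁ (component-closed G x∈K xy y∈X)
    ... | inj₂ (inj₂ y∈Y) = inj₂ (x∈p∪q⁺ (inj₂ (x∈p∩q⁺ (∈neighbourhood⁺ G x∈K xy , y∈Y))))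

  no-cross-edges : u ∈ X → v ∈ X → ¬ WalkIn G X u v → edgeCount G X Y ≡ 0
  no-cross-edges {u} {v} u∈X v∈X ¬u⇝v = n≤0⇒n≡0 (+-cancelˡ-≤ cross _ _ (begin
    cross + cross                                            ≤⟨ +-mono-≤
                                                                  (cross≤edgeCount-component u∈X v∈X ¬u⇝v)
                                                                  (cross≤edgeCount-component v∈X u∈X ¬v⇝u) ⟩
    edgeCount G (component G X u) Y + edgeCount G (component G X v) Y
                                                             ≤⟨ sumOver-disjoint _ (components-disjoint G v∈X ¬u⇝v)
                                                                  (component⊆ G u∈X) (component⊆ G v∈X) ⟩
    cross                                                    ≡⟨ sym (+-identityʳ cross) ⟩
    cross + 0                                                ∎))
    where
    open ≤-Reasoning
    cross : ℕ
    cross = edgeCount G X Y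
    ¬v⇝u : ¬ WalkIn G X v u
    ¬v⇝u = ¬u⇝v ∘ reverse G v∈X

  module _ {u v p q : V G} (u∈X : u ∈ X) (v∈X : v ∈ X) (¬u⇝v : ¬ WalkIn G X u v)
                           (p∈Y : p ∈ Y) (q∈Y : q ∈ Y) (¬p⇝q : ¬ WalkIn G Y p q) where

    private
      cross≡0 : edgeCount G X Y ≡ 0
      cross≡0 = no-cross-edges u∈X v∈X ¬u⇝v

      ¬v⇝u : ¬ WalkIn G X v u
      ¬v⇝u = ¬u⇝v ∘ reverse G v∈X

      ¬q⇝p : ¬ WalkIn G Y q p
      ¬q⇝p = ¬p⇝q ∘ reverse G q∈Y

    ∣Z∣≡3 : ∣ Z ∣ ≡ 3
    ∣Z∣≡3 = trans (sym (+-identityʳ ∣ Z ∣)) (subst (λ c → ∣ Z ∣ + c ≡ 3) cross≡0 ∣Z∣+cross≡3)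

    ∂X⊆Z : BoundaryWithin G X Z
    ∂X⊆Z {x} {y} x∈X xy with region y
    ... | inj₁ y∈Z        = inj₂ y∈Z
    ... | inj₂ (inj₁ y∈X) = inj₁ y∈X
    ... | inj₂ (inj₂ y∈Y) = ⊥-elim (edgeCount≡0⇒¬Adj G cross≡0 x∈X y∈Y xy)

    ∂Y⊆Z : BoundaryWithin G Y Z
    ∂Y⊆Z {x} {y} x∈Y xy with region y
    ... | inj₁ y∈Z        = inj₂ y∈Z
    ... | inj₂ (inj₁ y∈X) = ⊥-elim (edgeCount≡0⇒¬Adj G cross≡0 y∈X x∈Y (Adj-sym G xy))
    ... | inj₂ (inj₂ y∈Y) = inj₁ y∈Y

    K C D : VSet G
    K = component G X u ∪ component G Y p
    C = Z ∪ K
    D = ∁ K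

    private
      X∩Cp=∅ : x ∈ X → x ∉ component G Y p
      X∩Cp=∅ x∈X = X∩Y=∅ x∈X ∘ component⊆ G p∈Y

      Y∩Cu=∅ : x ∈ Y → x ∉ component G X u
      Y∩Cu=∅ x∈Y x∈Cu = X∩Y=∅ (component⊆ G u∈X x∈Cu) x∈Y

      ∉K : x ∉ component G X u → x ∉ component G Y p → x ∉ K
      ∉K x∉Cu x∉Cp x∈K = [ x∉Cu , x∉Cp ] (x∈p∪q⁻ _ _ x∈K)

      ∉C : x ∉ Z → x ∉ K → x ∉ C
      ∉C x∉Z x∉K x∈C = [ x∉Z , x∉K ] (x∈p∪q⁻ Z K x∈C)

      u∈K : u ∈ K
      u∈K = x∈p∪q⁺ (inj₁ (∈component-self G X _))

      p∈K : p ∈ K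
      p∈K = x∈p∪q⁺ (inj₂ (∈component-self G Y _))

      v∉K : v ∉ K
      v∉K = ∉K (¬u⇝v ∘ ∈component⁻ G) (X∩Cp=∅ v∈X)

      q∉K : q ∉ K
      q∉K = ∉K (Y∩Cu=∅ q∈Y) (¬p⇝q ∘ ∈component⁻ G)

      K∩Z=∅ : x ∈ K → x ∉ Z
      K∩Z=∅ x∈K = [ X∩Z=∅ ∘ component⊆ G u∈X , Y∩Z=∅ ∘ component⊆ G p∈Y ] (x∈p∪q⁻ _ _ x∈K)

      X,Y-components-disjoint : ∀ {a b} → a ∈ X → b ∈ Y → x ∈ component G X a → x ∉ component G Y b
      X,Y-components-disjoint a∈X b∈Y x∈Ca = X∩Y=∅ (component⊆ G a∈X x∈Ca) ∘ component⊆ G b∈Y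

      Cu⊆C : component G X u ⊆ C
      Cu⊆C = x∈p∪q⁺ ∘ inj₂ ∘ x∈p∪q⁺ ∘ inj₁

      Cp⊆C : component G Y p ⊆ C
      Cp⊆C = x∈p∪q⁺ ∘ inj₂ ∘ x∈p∪q⁺ ∘ inj₂

      Cv⊆D : component G X v ⊆ D
      Cv⊆D x∈Cv = x∉p⇒x∈∁p (∉K (components-disjoint G u∈X ¬v⇝u x∈Cv) (X∩Cp=∅ (component⊆ G v∈X x∈Cv)))

      Cq⊆D : component G Y q ⊆ D
      Cq⊆D x∈Cq = x∉p⇒x∈∁p (∉K (Y∩Cu=∅ (component⊆ G q∈Y x∈Cq)) (components-disjoint G p∈Y ¬q⇝p x∈Cq))

      ∂K⊆Z : BoundaryWithin G K Z
      ∂K⊆Z = boundary-∪ G (component-boundary G u∈X ∂X⊆Z) (component-boundary G p∈Y ∂Y⊆Z)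

    C∪D≡⊤ : C ∪ D ≡ ⊤
    C∪D≡⊤ = ⊆-antisym ⊆⊤ λ {x} _ → ∈C∪D x
      where
      ∈C∪D : ∀ x → x ∈ C ∪ D
      ∈C∪D x with x ∈? K
      ... | yes x∈K = x∈p∪q⁺ (inj₁ (x∈p∪q⁺ (inj₂ x∈K)))
      ... | no x∉K  = x∈p∪q⁺ (inj₂ (x∉p⇒x∈∁p x∉K))

    C∩D≡Z : C ∩ D ≡ Z
    C∩D≡Z = ⊆-antisym C∩D⊆Z Z⊆C∩D
      where
      C∩D⊆Z : C ∩ D ⊆ Z
      C∩D⊆Z x∈C∩D with x∈p∩q⁻ C D x∈C∩D
      ... | x∈C , x∈D = [ id , (λ x∈K → ⊥-elim (x∈∁p⇒x∉p x∈D x∈K)) ] (x∈p∪q⁻ Z K x∈C)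
      Z⊆C∩D : Z ⊆ C ∩ D
      Z⊆C∩D x∈Z = x∈p∩q⁺ (x∈p∪q⁺ (inj₁ x∈Z) , x∉p⇒x∈∁p (λ x∈K → K∩Z=∅ x∈K x∈Z))

    C,D-cross≡0 : crossEdges G C D ≡ 0
    C,D-cross≡0 = trans (crossEdges≡edgeCount G C D) (¬Adj⇒edgeCount≡0 G ¬adj)
      where
      ¬adj : x ∈ C ─ D → y ∈ D ─ C → ¬ Adj G x y
      ¬adj x∈C─D y∈D─C xy with ∂K⊆Z (x∉∁p⇒x∈p (x∈p─q⇒x∉q C D x∈C─D)) xy
      ... | inj₁ y∈K = x∈∁p⇒x∉p (p─q⊆p D C y∈D─C) y∈K
      ... | inj₂ y∈Z = x∈p─q⇒x∉q D C y∈D─C (x∈p∪q⁺ (inj₁ y∈Z))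

    C,D-degrees : ∀ z → z ∈ C ∩ D → (∣ N G z ∩ C ∣ ≥ 2) × (∣ N G z ∩ D ∣ ≥ 2)
    C,D-degrees z z∈C∩D =
        two-neighbours G (attachedX u∈X v∈X ¬u⇝v) (attachedY p∈Y q∈Y ¬p⇝q) (X,Y-components-disjoint u∈X p∈Y) Cu⊆C Cp⊆C
      , two-neighbours G (attachedX v∈X u∈X ¬v⇝u) (attachedY q∈Y p∈Y ¬q⇝p) (X,Y-components-disjoint v∈X q∈Y) Cv⊆D Cq⊆D
      where
      z∈Z : z ∈ Z
      z∈Z = subst (z ∈_) C∩D≡Z z∈C∩D
      attachedX : ∀ {a b} → a ∈ X → b ∈ X → ¬ WalkIn G X a b → ∃ λ c → c ∈ component G X a × Adj G z c
      attachedX a∈X b∈X ¬a⇝b = component-attached G tc ∂X⊆Z (≤-reflexive ∣Z∣≡3) X∩Z=∅ a∈X b∈X ¬a⇝b z∈Z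
      attachedY : ∀ {a b} → a ∈ Y → b ∈ Y → ¬ WalkIn G Y a b → ∃ λ c → c ∈ component G Y a × Adj G z c
      attachedY a∈Y b∈Y ¬a⇝b = component-attached G tc ∂Y⊆Z (≤-reflexive ∣Z∣≡3) Y∩Z=∅ a∈Y b∈Y ¬a⇝b z∈Z

    C,D-triSep : IsTriSep G C D
    C,D-triSep =
        (C∪D≡⊤ , (u , x∈p∧x∉q⇒x∈p─q (x∈p∪q⁺ (inj₂ u∈K)) (x∈p⇒x∉∁p u∈K))
               , (v , x∈p∧x∉q⇒x∈p─q (x∉p⇒x∈∁p v∉K) (∉C (X∩Z=∅ v∈X) v∉K)))
      , trans (cong₂ _+_ (cong ∣_∣ C∩D≡Z) C,D-cross≡0) (trans (+-identityʳ ∣ Z ∣) ∣Z∣≡3)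
      , C,D-degrees

    A,B-C,D-crossing : ¬ Nested G A B C D
    A,B-C,D-crossing (inj₁ (A⊆C , _))                 = ∉C (X∩Z=∅ v∈X) v∉K (A⊆C (p─q⊆p A B v∈X))
    A,B-C,D-crossing (inj₂ (inj₁ (B⊆C , _)))          = ∉C (Y∩Z=∅ q∈Y) q∉K (B⊆C (p─q⊆p B A q∈Y))
    A,B-C,D-crossing (inj₂ (inj₂ (inj₁ (A⊆D , _))))   = x∈p⇒x∉∁p u∈K (A⊆D (p─q⊆p A B u∈X))
    A,B-C,D-crossing (inj₂ (inj₂ (inj₂ (B⊆D , _))))   = x∈p⇒x∉∁p p∈K (B⊆D (p─q⊆p B A p∈Y))

    not-totally-nested : ¬ TotallyNested G A B
    not-totally-nested nested = A,B-C,D-crossing (nested C D C,D-triSep)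

mainTheorem14 : (G : Graph) → ThreeConnected G → (A B : VSet G)
    → IsTriSep G A B → TotallyNested G A B → HalfConnected G A B
mainTheorem14 G tc A B ts nested
  with connected-or-split G (proj₁ (proj₂ (proj₁ ts))) | connected-or-split G (proj₂ (proj₂ (proj₁ ts)))
... | inj₁ X-connected | _                = inj₁ X-connected
... | inj₂ _           | inj₁ Y-connected = inj₂ Y-connected
... | inj₂ (u , v , u∈X , v∈X , ¬u⇝v) | inj₂ (p , q , p∈Y , q∈Y , ¬p⇝q) =
  ⊥-elim (not-totally-nested G tc ts u∈X v∈X ¬u⇝v p∈Y q∈Y ¬p⇝q nested)
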